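{- Let $H$ be a graph of order $n$ and let $p$ be a positive integer. If $p\geq \frac{n^2}{4(n+1)}$, then the independence polynomial $I(H\circ K_p;x)$ is log-concave.
   Context: All graphs are finite, simple, undirected and loopless. $K_p$ denotes the complete graph on $p$ vertices. The clique corona $H\circ K_p$ is the graph obtained from $H$ by taking, for each vertex $v\in V(H)$, a disjoint copy $K^{(v)}$ of $K_p$, and joining $v$ by edges to all vertices of $K^{(v)}$. An independent set is a set of pairwise non-adjacent vertices; $\alpha(G)$ is the maximum size of an independent set. The independence polynomial is $I(G;x)=\sum_{k=0}^{\alpha(G)} s_k x^k$, where $s_k$ is the number of independent sets of size $k$ in $G$; it is log-concave if $s_k^2\geq s_{k-1}s_{k+1}$ for all $1\le k\le \alpha(G)-1$. -}

module Defs where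

open import Data.Bool using (Bool; true; false; _∧_; _∨_; not; if_then_else_)
open import Data.Nat using (ℕ; zero; suc; _+_; _*_; _∸_; _≤_; _⊔_)
open import Data.Fin using (Fin; splitAt; remQuot)
open import Data.Fin.Properties using (_≟_)
open import Data.Sum using (_⊎_; inj₁; inj₂)
open import Data.Product using (_×_; _,_)
open import Data.List using (List; []; _∷_; map; filter; length; foldr; _++_; allFin)
open import Data.Vec using (Vec; []; _∷_; lookup)
open import Relation.Binary.PropositionalEquality using (_≡_)
open import Relation.Nullary.Decidable using (⌊_⌋)

record Graph (n : ℕ) : Set where
  field
    adj      : Fin n → Fin n → Bool
    adj-sym  : ∀ i j → adj i j ≡ adj j i
    adj-irr  : ∀ i → adj i i ≡ false
open Graph public

completeAdj : {p : ℕ} → Fin p → Fin p → Bool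
completeAdj i j = not ⌊ i ≟ j ⌋

-- Vertex set Fin (n + n * p): the first n vertices are
-- the vertices of H; a vertex in the second block decodes (via remQuot) to a
-- pair (v , a), meaning vertex a of the copy K^(v) of K_p attached to v.
Vtx : ℕ → ℕ → Set
Vtx n p = Fin n ⊎ (Fin n × Fin p)

decode : (n p : ℕ) → Fin (n + n * p) → Vtx n p
decode n p x with splitAt n x
... | inj₁ v = inj₁ v
... | inj₂ y = inj₂ (remQuot p y)

coronaAdjV : {n p : ℕ} → Graph n → Vtx n p → Vtx n p → Bool
coronaAdjV H (inj₁ u) (inj₁ v) = adj H u v
coronaAdjV H (inj₁ u) (inj₂ (v , _)) = ⌊ u ≟ v ⌋
coronaAdjV H (inj₂ (u , _)) (inj₁ v) = ⌊ u ≟ v ⌋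
coronaAdjV H (inj₂ (u , a)) (inj₂ (v , b)) = ⌊ u ≟ v ⌋ ∧ not ⌊ a ≟ b ⌋

coronaAdj : {n : ℕ} → Graph n → (p : ℕ) → Fin (n + n * p) → Fin (n + n * p) → Bool
coronaAdj {n} H p x y = coronaAdjV H (decode n p x) (decode n p y)

allSubsets : (m : ℕ) → List (Vec Bool m)
allSubsets zero = [] ∷ []
allSubsets (suc m) = map (true ∷_) (allSubsets m) ++ map (false ∷_) (allSubsets m)

size : {m : ℕ} → Vec Bool m → ℕ
size [] = 0
size (true ∷ s) = suc (size s)
size (false ∷ s) = size s

andL : List Bool → Bool
andL = foldr _∧_ true

isIndependent : {m : ℕ} → (Fin m → Fin m → Bool) → Vec Bool m → Bool
isIndependent {m} A S =
  andL (map (λ i → andL (map (λ j → not (lookup S i ∧ lookup S j ∧ A i j)) (allFin m))) (allFin m))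

independentSets : {m : ℕ} → (Fin m → Fin m → Bool) → List (Vec Bool m)
independentSets {m} A = filter (λ S → isIndependent A S ≡? true) (allSubsets m)
  where
  open import Data.Bool.Properties using () renaming (_≟_ to _≡?_)

indepCoeff : {m : ℕ} → (Fin m → Fin m → Bool) → ℕ → ℕ
indepCoeff A k = length (filter (λ S → size S Data.Nat.≟ k) (independentSets A))

indepNumber : {m : ℕ} → (Fin m → Fin m → Bool) → ℕ
indepNumber A = foldr (λ S r → size S ⊔ r) 0 (independentSets A)

IsLogConcaveIndepPoly : {m : ℕ} → (Fin m → Fin m → Bool) → Set
IsLogConcaveIndepPoly A =
  ∀ k → 1 ≤ k → k ≤ indepNumber A ∸ 1 →
    indepCoeff A (k ∸ 1) * indepCoeff A (suc k) ≤ indepCoeff A k * indepCoeff A k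

-- Let ext S be the number of vertices that can be added to an independent set S keeping it
-- independent. Counting pairs (S , x) gives Σ_{|S| = k} ext S = (k + 1) s_{k+1}, so bounds
-- L ≤ ext S ≤ U over the independent k-sets give L s_k ≤ (k + 1) s_{k+1} ≤ U s_k.
-- In H ∘ K_p the blocks {v} ∪ K^(v) are cliques partitioning the vertex set, and an independent
-- k-set misses exactly n − k of them; a missed block offers all p vertices of K^(v) and possibly v,
-- a hit block offers nothing. Hence p (n − k) s_k ≤ (k + 1) s_{k+1} ≤ (p + 1) (n − k) s_k.
-- Multiplying the lower bound at k − 1 with the upper bound at k gives s_{k−1} s_{k+1} ≤ s_k²
-- as soon as k (n − k) ≤ p (n + 1), and k (n − k) ≤ n² / 4 ≤ p (n + 1) by AM–GM.
module Submission where

open import Defs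
open import Data.Bool using (Bool; true; false; _∧_; not; T)
open import Data.Bool.ListAction using (all)
open import Data.Bool.Properties using (T-≡; T-not-≡; ¬-not) renaming (_≟_ to _≟ᵇ_)
open import Data.Empty using (⊥-elim)
open import Data.Fin using (Fin; zero; suc; _↑ˡ_; _↑ʳ_; combine; punchIn; splitAt)
open import Data.Fin.Properties
  using (punchInᵢ≢i; any?; splitAt-↑ˡ; splitAt-↑ʳ; join-splitAt; remQuot-combine; combine-remQuot)
  renaming (_≟_ to _≟ᶠ_)
open import Data.List using ([]; _∷_; _++_; map; filter; length; allFin)
open import Data.List.Membership.Propositional.Properties using (∈-allFin)
open import Data.List.Properties using (map-++; map-∘)
import Data.List.Relation.Unary.All as All
open import Data.List.Relation.Unary.All.Properties using (all⁺; all⁻)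
open import Data.Nat
open import Data.Nat.Properties
open import Data.Nat.ListAction using () renaming (sum to sumˡ)
open import Data.Nat.ListAction.Properties using () renaming (sum-++ to sumˡ-++)
open import Data.Nat.Tactic.RingSolver using (solve-∀)
open import Data.Product using (_×_; _,_; proj₁; proj₂; ∃; uncurry)
open import Data.Sum using (_⊎_; inj₁; inj₂)
open import Data.Vec using (Vec; []; _∷_; lookup; _[_]≔_)
open import Data.Vec.Properties using (lookup∘update; lookup∘update′)
open import Function using (_∘_; Equivalence)
open import Relation.Binary.PropositionalEquality
open import Relation.Nullary using (does; yes; no; ¬_)
open import Relation.Nullary.Decidable using (⌊_⌋; isYes≗does; dec-true; dec-false)
open import Relation.Unary using (Decidable)
open import Algebra.Properties.Semiring.Sum +-*-semiring
  using (sum; sum-syntax; sum-cong-≗; ∑-distrib-+; *-distribˡ-sum; *-distribʳ-sum; sum-remove;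
         sum-replicate-zero)

⟦_⟧ : Bool → ℕ
⟦ true ⟧ = 1
⟦ false ⟧ = 0

⟦⟧≤1 : ∀ b → ⟦ b ⟧ ≤ 1
⟦⟧≤1 true = ≤-refl
⟦⟧≤1 false = z≤n

⟦∧⟧ : ∀ a b → ⟦ a ∧ b ⟧ ≡ ⟦ a ⟧ * ⟦ b ⟧
⟦∧⟧ true b = sym (+-identityʳ ⟦ b ⟧)
⟦∧⟧ false b = refl

⟦⟧*-mono-≤ : ∀ b {x y} → (b ≡ true → x ≤ y) → ⟦ b ⟧ * x ≤ ⟦ b ⟧ * y
⟦⟧*-mono-≤ true x≤y = *-monoʳ-≤ 1 (x≤y refl)
⟦⟧*-mono-≤ false _ = z≤n

∑-mono-≤ : ∀ {n} {f g : Fin n → ℕ} → (∀ i → f i ≤ g i) → sum f ≤ sum g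
∑-mono-≤ {zero} f≤g = z≤n
∑-mono-≤ {suc n} f≤g = +-mono-≤ (f≤g zero) (∑-mono-≤ (f≤g ∘ suc))

∑-zero : ∀ {n} {f : Fin n → ℕ} → (∀ i → f i ≡ 0) → sum f ≡ 0
∑-zero {n} f≡0 = trans (sum-cong-≗ f≡0) (sum-replicate-zero n)

∑-one : ∀ n → ∑[ i < n ] 1 ≡ n
∑-one zero = refl
∑-one (suc n) = cong suc (∑-one n)

∑-↑ˡ-↑ʳ : ∀ a b (f : Fin (a + b) → ℕ) → sum f ≡ ∑[ i < a ] f (i ↑ˡ b) + ∑[ j < b ] f (a ↑ʳ j)
∑-↑ˡ-↑ʳ zero b f = refl
∑-↑ˡ-↑ʳ (suc a) b f = trans (cong (f zero +_) (∑-↑ˡ-↑ʳ a b (f ∘ suc))) (sym (+-assoc (f zero) _ _))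

∑-combine : ∀ n p (f : Fin (n * p) → ℕ) → sum f ≡ ∑[ v < n ] ∑[ a < p ] f (combine v a)
∑-combine zero p f = refl
∑-combine (suc n) p f =
  trans (∑-↑ˡ-↑ʳ p (n * p) f) (cong (∑[ a < p ] f (a ↑ˡ n * p) +_) (∑-combine n p (f ∘ (p ↑ʳ_))))

∑-⟦⟧-unique : ∀ {n} (f : Fin (suc n) → Bool) i → f i ≡ true → (∀ j → j ≢ i → f j ≡ false) →
  ∑[ j < suc n ] ⟦ f j ⟧ ≡ 1
∑-⟦⟧-unique {n} f i fi others = begin
  ∑[ j < suc n ] ⟦ f j ⟧                      ≡⟨ sum-remove {i = i} (⟦_⟧ ∘ f) ⟩
  ⟦ f i ⟧ + ∑[ j < n ] ⟦ f (punchIn i j) ⟧    ≡⟨ cong₂ _+_ (cong ⟦_⟧ fi) (∑-zero (cong ⟦_⟧ ∘ rest)) ⟩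
  1                                           ∎
  where
  open ≡-Reasoning
  rest : ∀ j → f (punchIn i j) ≡ false
  rest j = others (punchIn i j) (punchInᵢ≢i i j)

∑-1∸ : ∀ {n} (f : Fin n → ℕ) → (∀ i → f i ≤ 1) → ∑[ i < n ] (1 ∸ f i) ≡ n ∸ sum f
∑-1∸ {zero} f f≤1 = refl
∑-1∸ {suc n} f f≤1 with f zero | f≤1 zero
... | 0 | _ = trans (cong suc (∑-1∸ (f ∘ suc) (f≤1 ∘ suc)))
                    (sym (+-∸-assoc 1 (≤-trans (∑-mono-≤ (f≤1 ∘ suc)) (≤-reflexive (∑-one n)))))
... | 1 | _ = ∑-1∸ (f ∘ suc) (f≤1 ∘ suc)
... | 2+ _ | s≤s ()

size≡∑ : ∀ {m} (S : Vec Bool m) → size S ≡ ∑[ i < m ] ⟦ lookup S i ⟧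
size≡∑ [] = refl
size≡∑ (true ∷ S) = cong suc (size≡∑ S)
size≡∑ (false ∷ S) = size≡∑ S

size-[]≔true : ∀ {m} (S : Vec Bool m) i → lookup S i ≡ false → size (S [ i ]≔ true) ≡ suc (size S)
size-[]≔true (false ∷ S) zero _ = refl
size-[]≔true (true ∷ S) (suc i) Si = cong suc (size-[]≔true S i Si)
size-[]≔true (false ∷ S) (suc i) Si = size-[]≔true S i Si

lookup-[]≔true-mono : ∀ {m} (S : Vec Bool m) x {i} → lookup S i ≡ true → lookup (S [ x ]≔ true) i ≡ true
lookup-[]≔true-mono S x {i} Si with x ≟ᶠ i
... | yes refl = lookup∘update x S true
... | no x≢i = trans (lookup∘update′ (x≢i ∘ sym) S true) Si

∑⊆ : ∀ {m} → (Vec Bool m → ℕ) → ℕ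
∑⊆ {zero} f = f []
∑⊆ {suc m} f = ∑⊆ (f ∘ (true ∷_)) + ∑⊆ (f ∘ (false ∷_))

∑⊆-cong : ∀ {m} {f g : Vec Bool m → ℕ} → (∀ S → f S ≡ g S) → ∑⊆ f ≡ ∑⊆ g
∑⊆-cong {zero} f≡g = f≡g []
∑⊆-cong {suc m} f≡g = cong₂ _+_ (∑⊆-cong (f≡g ∘ (true ∷_))) (∑⊆-cong (f≡g ∘ (false ∷_)))

∑⊆-mono-≤ : ∀ {m} {f g : Vec Bool m → ℕ} → (∀ S → f S ≤ g S) → ∑⊆ f ≤ ∑⊆ g
∑⊆-mono-≤ {zero} f≤g = f≤g []
∑⊆-mono-≤ {suc m} f≤g = +-mono-≤ (∑⊆-mono-≤ (f≤g ∘ (true ∷_))) (∑⊆-mono-≤ (f≤g ∘ (false ∷_)))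

∑⊆-zero : ∀ m → ∑⊆ {m} (λ _ → 0) ≡ 0
∑⊆-zero zero = refl
∑⊆-zero (suc m) = cong₂ _+_ (∑⊆-zero m) (∑⊆-zero m)

*-distribˡ-∑⊆ : ∀ {m} c (f : Vec Bool m → ℕ) → c * ∑⊆ f ≡ ∑⊆ (λ S → c * f S)
*-distribˡ-∑⊆ {zero} c f = refl
*-distribˡ-∑⊆ {suc m} c f = trans (*-distribˡ-+ c _ _)
  (cong₂ _+_ (*-distribˡ-∑⊆ c (f ∘ (true ∷_))) (*-distribˡ-∑⊆ c (f ∘ (false ∷_))))

∑⊆-∑-comm : ∀ {m n} (f : Vec Bool m → Fin n → ℕ) →
  ∑⊆ (λ S → ∑[ i < n ] f S i) ≡ ∑[ i < n ] ∑⊆ (λ S → f S i)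
∑⊆-∑-comm {zero} f = refl
∑⊆-∑-comm {suc m} {n} f = trans (cong₂ _+_ (∑⊆-∑-comm (f ∘ (true ∷_))) (∑⊆-∑-comm (f ∘ (false ∷_))))
  (sym (∑-distrib-+ {n} _ _))

-- S ↦ S [ x ]≔ true is a bijection from the subsets avoiding x onto those containing x.
∑⊆-insert : ∀ {m} (x : Fin m) (g : Vec Bool m → ℕ) →
  ∑⊆ (λ S → ⟦ not (lookup S x) ⟧ * g (S [ x ]≔ true)) ≡ ∑⊆ (λ T → ⟦ lookup T x ⟧ * g T)
∑⊆-insert {suc m} zero g rewrite ∑⊆-zero m = sym (+-identityʳ _)
∑⊆-insert {suc m} (suc x) g = cong₂ _+_ (∑⊆-insert x (g ∘ (true ∷_))) (∑⊆-insert x (g ∘ (false ∷_)))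

sumˡ-map-allSubsets : ∀ m (f : Vec Bool m → ℕ) → sumˡ (map f (allSubsets m)) ≡ ∑⊆ f
sumˡ-map-allSubsets zero f = +-identityʳ (f [])
sumˡ-map-allSubsets (suc m) f = begin
  sumˡ (map f (map (true ∷_) xs ++ map (false ∷_) xs))
    ≡⟨ cong sumˡ (map-++ f (map (true ∷_) xs) _) ⟩
  sumˡ (map f (map (true ∷_) xs) ++ map f (map (false ∷_) xs))
    ≡⟨ sumˡ-++ (map f (map (true ∷_) xs)) _ ⟩
  sumˡ (map f (map (true ∷_) xs)) + sumˡ (map f (map (false ∷_) xs))
    ≡⟨ cong₂ (λ ys zs → sumˡ ys + sumˡ zs) (map-∘ xs) (map-∘ xs) ⟨
  sumˡ (map (f ∘ (true ∷_)) xs) + sumˡ (map (f ∘ (false ∷_)) xs)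
    ≡⟨ cong₂ _+_ (sumˡ-map-allSubsets m _) (sumˡ-map-allSubsets m _) ⟩
  ∑⊆ f ∎
  where
  open ≡-Reasoning
  xs = allSubsets m

module _ {A : Set} {P : A → Set} (P? : Decidable P) where

  length-filter : ∀ xs → length (filter P? xs) ≡ sumˡ (map (λ x → ⟦ does (P? x) ⟧) xs)
  length-filter [] = refl
  length-filter (x ∷ xs) with does (P? x)
  ... | true = cong suc (length-filter xs)
  ... | false = length-filter xs

  sumˡ-map-filter : ∀ (f : A → ℕ) xs →
    sumˡ (map f (filter P? xs)) ≡ sumˡ (map (λ x → ⟦ does (P? x) ⟧ * f x) xs)
  sumˡ-map-filter f [] = refl
  sumˡ-map-filter f (x ∷ xs) with does (P? x)
  ... | true = cong₂ _+_ (sym (+-identityʳ (f x))) (sumˡ-map-filter f xs)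
  ... | false = sumˡ-map-filter f xs

module IndependentSets {m : ℕ} (A : Fin m → Fin m → Bool) where

  Independent : Vec Bool m → Set
  Independent S = ∀ i j → lookup S i ≡ true → lookup S j ≡ true → A i j ≡ false

  private
    noEdgeIn : Vec Bool m → Fin m → Fin m → Bool
    noEdgeIn S i j = not (lookup S i ∧ lookup S j ∧ A i j)

    noEdgeFrom : Vec Bool m → Fin m → Bool
    noEdgeFrom S i = all (noEdgeIn S i) (allFin m)

  isIndependent⇒Independent : ∀ S → isIndependent A S ≡ true → Independent S
  isIndependent⇒Independent S ind i j Si Sj = noEdge (lookup S i) (lookup S j) Si Sj pairOk
    where
    pairOk : T (noEdgeIn S i j)
    pairOk = All.lookup (all⁺ (noEdgeIn S i) (allFin m)
      (All.lookup (all⁺ (noEdgeFrom S) (allFin m) (Equivalence.from T-≡ ind)) (∈-allFin i))) (∈-allFin j)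
    noEdge : ∀ a b → a ≡ true → b ≡ true → T (not (a ∧ b ∧ A i j)) → A i j ≡ false
    noEdge true true _ _ = Equivalence.to T-not-≡

  Independent⇒isIndependent : ∀ S → Independent S → isIndependent A S ≡ true
  Independent⇒isIndependent S ind =
    Equivalence.to T-≡ (all⁻ (noEdgeFrom S) (All.tabulate {xs = allFin m} λ {i} _ → row i))
    where
    pairOk : ∀ i j → T (noEdgeIn S i j)
    pairOk i j with lookup S i in Si | lookup S j in Sj
    ... | false | _ = _
    ... | true | false = _
    ... | true | true = Equivalence.from T-not-≡ (ind i j Si Sj)
    row : ∀ i → T (noEdgeFrom S i)
    row i = all⁻ (noEdgeIn S i) (All.tabulate {xs = allFin m} λ {j} _ → pairOk i j)

  Independent-[]≔⁻ : ∀ S x → Independent (S [ x ]≔ true) → Independent S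
  Independent-[]≔⁻ S x ind i j Si Sj = ind i j (lookup-[]≔true-mono S x Si) (lookup-[]≔true-mono S x Sj)

  addable : Vec Bool m → Fin m → Bool
  addable S x = not (lookup S x) ∧ isIndependent A (S [ x ]≔ true)

  extensions : Vec Bool m → ℕ
  extensions S = ∑[ x < m ] ⟦ addable S x ⟧

  addable-member : ∀ S {x} → lookup S x ≡ true → addable S x ≡ false
  addable-member S Sx rewrite Sx = refl

  addable-adjacent : ∀ S {x y} → lookup S y ≡ true → A x y ≡ true → addable S x ≡ false
  addable-adjacent S {x} {y} Sy Axy with lookup S x | isIndependent A (S [ x ]≔ true) in ind
  ... | true | _ = refl
  ... | false | false = refl
  ... | false | true with () ← trans (sym Axy) (isIndependent⇒Independent (S [ x ]≔ true) ind x y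
                                                   (lookup∘update x S true) (lookup-[]≔true-mono S x Sy))

  addable-isolated : ∀ S {x} → Independent S → lookup S x ≡ false → A x x ≡ false →
    (∀ y → lookup S y ≡ true → A x y ≡ false) → (∀ y → lookup S y ≡ true → A y x ≡ false) →
    addable S x ≡ true
  addable-isolated S {x} ind Sx Axx x↛S S↛x rewrite Sx =
    Independent⇒isIndependent (S [ x ]≔ true) ind′
    where
    unchanged : ∀ {i} → i ≢ x → lookup (S [ x ]≔ true) i ≡ true → lookup S i ≡ true
    unchanged i≢x = trans (sym (lookup∘update′ i≢x S true))
    ind′ : Independent (S [ x ]≔ true)
    ind′ i j Si Sj with i ≟ᶠ x | j ≟ᶠ x
    ... | yes refl | yes refl = Axx
    ... | yes refl | no j≢x = x↛S j (unchanged j≢x Sj)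
    ... | no i≢x | yes refl = S↛x i (unchanged i≢x Si)
    ... | no i≢x | no j≢x = ind i j (unchanged i≢x Si) (unchanged j≢x Sj)

  isIndependentOfSize : ℕ → Vec Bool m → Bool
  isIndependentOfSize k S = isIndependent A S ∧ (size S ≡ᵇ k)

  isIndependentOfSize⇒ : ∀ k S → isIndependentOfSize k S ≡ true → Independent S × size S ≡ k
  isIndependentOfSize⇒ k S eq with isIndependent A S in ind | size S ≡ᵇ k in sz
  ... | true | true = isIndependent⇒Independent S ind , ≡ᵇ⇒≡ (size S) k (Equivalence.from T-≡ sz)

  indepCoeff≡∑⊆ : ∀ k → indepCoeff A k ≡ ∑⊆ (⟦_⟧ ∘ isIndependentOfSize k)
  indepCoeff≡∑⊆ k = begin
    indepCoeff A k
      ≡⟨ length-filter (λ S → size S ≟ k) (independentSets A) ⟩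
    sumˡ (map (λ S → ⟦ size S ≡ᵇ k ⟧) (independentSets A))
      ≡⟨ sumˡ-map-filter (λ S → isIndependent A S ≟ᵇ true) _ (allSubsets m) ⟩
    sumˡ (map (λ S → ⟦ does (isIndependent A S ≟ᵇ true) ⟧ * ⟦ size S ≡ᵇ k ⟧) (allSubsets m))
      ≡⟨ sumˡ-map-allSubsets m _ ⟩
    ∑⊆ (λ S → ⟦ does (isIndependent A S ≟ᵇ true) ⟧ * ⟦ size S ≡ᵇ k ⟧)
      ≡⟨ ∑⊆-cong (λ S → sym (⟦∧⟧ (does (isIndependent A S ≟ᵇ true)) _)) ⟩
    ∑⊆ (λ S → ⟦ does (isIndependent A S ≟ᵇ true) ∧ (size S ≡ᵇ k) ⟧)
      ≡⟨ ∑⊆-cong (λ S → cong (λ b → ⟦ b ∧ (size S ≡ᵇ k) ⟧) (does-≟true (isIndependent A S))) ⟩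
    ∑⊆ (⟦_⟧ ∘ isIndependentOfSize k) ∎
    where
    open ≡-Reasoning
    does-≟true : ∀ b → does (b ≟ᵇ true) ≡ b
    does-≟true true = refl
    does-≟true false = refl

  ⟦isIndependentOfSize⟧*⟦addable⟧ : ∀ k S x →
    ⟦ isIndependentOfSize k S ⟧ * ⟦ addable S x ⟧ ≡
    ⟦ not (lookup S x) ⟧ * ⟦ isIndependentOfSize (suc k) (S [ x ]≔ true) ⟧
  ⟦isIndependentOfSize⟧*⟦addable⟧ k S x with lookup S x in Sx
  ... | true = *-zeroʳ ⟦ isIndependentOfSize k S ⟧
  ... | false rewrite size-[]≔true S x Sx with isIndependent A (S [ x ]≔ true) in ind
  ...   | false = *-zeroʳ ⟦ isIndependentOfSize k S ⟧
  ...   | true rewrite Independent⇒isIndependent S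
                         (Independent-[]≔⁻ S x (isIndependent⇒Independent (S [ x ]≔ true) ind)) =
          *-comm ⟦ size S ≡ᵇ k ⟧ 1

  -- Double counting: an independent (k+1)-set T arises as S [ x ]≔ true from exactly k + 1 pairs (S , x).
  ∑⊆-extensions : ∀ k → ∑⊆ (λ S → ⟦ isIndependentOfSize k S ⟧ * extensions S) ≡ suc k * indepCoeff A (suc k)
  ∑⊆-extensions k = begin
    ∑⊆ (λ S → ⟦ I k S ⟧ * ∑[ x < m ] ⟦ addable S x ⟧)
      ≡⟨ ∑⊆-cong (λ S → *-distribˡ-sum ⟦ I k S ⟧ (⟦_⟧ ∘ addable S)) ⟩
    ∑⊆ (λ S → ∑[ x < m ] (⟦ I k S ⟧ * ⟦ addable S x ⟧))
      ≡⟨ ∑⊆-∑-comm (λ S x → ⟦ I k S ⟧ * ⟦ addable S x ⟧) ⟩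
    ∑[ x < m ] ∑⊆ (λ S → ⟦ I k S ⟧ * ⟦ addable S x ⟧)
      ≡⟨ sum-cong-≗ (λ x → ∑⊆-cong (λ S → ⟦isIndependentOfSize⟧*⟦addable⟧ k S x)) ⟩
    ∑[ x < m ] ∑⊆ (λ S → ⟦ not (lookup S x) ⟧ * ⟦ I (suc k) (S [ x ]≔ true) ⟧)
      ≡⟨ sum-cong-≗ (λ x → ∑⊆-insert x (⟦_⟧ ∘ I (suc k))) ⟩
    ∑[ x < m ] ∑⊆ (λ T → ⟦ lookup T x ⟧ * ⟦ I (suc k) T ⟧)
      ≡⟨ ∑⊆-∑-comm (λ T x → ⟦ lookup T x ⟧ * ⟦ I (suc k) T ⟧) ⟨
    ∑⊆ (λ T → ∑[ x < m ] (⟦ lookup T x ⟧ * ⟦ I (suc k) T ⟧))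
      ≡⟨ ∑⊆-cong (λ T → size*⟦I⟧≡∑ T) ⟨
    ∑⊆ (λ T → size T * ⟦ I (suc k) T ⟧)
      ≡⟨ ∑⊆-cong (λ T → size*⟦≡ᵇ⟧ (size T) (suc k) (isIndependent A T)) ⟩
    ∑⊆ (λ T → suc k * ⟦ I (suc k) T ⟧)
      ≡⟨ *-distribˡ-∑⊆ (suc k) (⟦_⟧ ∘ I (suc k)) ⟨
    suc k * ∑⊆ (⟦_⟧ ∘ I (suc k))
      ≡⟨ cong (suc k *_) (indepCoeff≡∑⊆ (suc k)) ⟨
    suc k * indepCoeff A (suc k) ∎
    where
    open ≡-Reasoning
    I : ℕ → Vec Bool m → Bool
    I = isIndependentOfSize
    size*⟦I⟧≡∑ : ∀ T → size T * ⟦ I (suc k) T ⟧ ≡ ∑[ x < m ] (⟦ lookup T x ⟧ * ⟦ I (suc k) T ⟧)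
    size*⟦I⟧≡∑ T =
      trans (cong (_* ⟦ I (suc k) T ⟧) (size≡∑ T)) (*-distribʳ-sum ⟦ I (suc k) T ⟧ (⟦_⟧ ∘ lookup T))
    size*⟦≡ᵇ⟧ : ∀ s k b → s * ⟦ b ∧ (s ≡ᵇ k) ⟧ ≡ k * ⟦ b ∧ (s ≡ᵇ k) ⟧
    size*⟦≡ᵇ⟧ s k false = trans (*-zeroʳ s) (sym (*-zeroʳ k))
    size*⟦≡ᵇ⟧ s k true with s ≡ᵇ k in s≡k
    ... | false = trans (*-zeroʳ s) (sym (*-zeroʳ k))
    ... | true = cong (_* 1) (≡ᵇ⇒≡ s k (Equivalence.from T-≡ s≡k))

  indepCoeff-ratio-bounds : ∀ k L U →
    (∀ S → Independent S → size S ≡ k → L ≤ extensions S × extensions S ≤ U) →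
    L * indepCoeff A k ≤ suc k * indepCoeff A (suc k) × suc k * indepCoeff A (suc k) ≤ U * indepCoeff A k
  indepCoeff-ratio-bounds k L U bounds = lower , upper
    where
    open ≤-Reasoning
    I : Vec Bool m → Bool
    I = isIndependentOfSize k
    bounds′ : ∀ S → I S ≡ true → L ≤ extensions S × extensions S ≤ U
    bounds′ S = uncurry (bounds S) ∘ isIndependentOfSize⇒ k S
    scaled : ∀ c → c * indepCoeff A k ≡ ∑⊆ (λ S → ⟦ I S ⟧ * c)
    scaled c = trans (cong (c *_) (indepCoeff≡∑⊆ k))
                     (trans (*-distribˡ-∑⊆ c (⟦_⟧ ∘ I)) (∑⊆-cong λ S → *-comm c ⟦ I S ⟧))
    lower : L * indepCoeff A k ≤ suc k * indepCoeff A (suc k)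
    lower = begin
      L * indepCoeff A k                   ≡⟨ scaled L ⟩
      ∑⊆ (λ S → ⟦ I S ⟧ * L)               ≤⟨ ∑⊆-mono-≤ (λ S → ⟦⟧*-mono-≤ (I S) (proj₁ ∘ bounds′ S)) ⟩
      ∑⊆ (λ S → ⟦ I S ⟧ * extensions S)    ≡⟨ ∑⊆-extensions k ⟩
      suc k * indepCoeff A (suc k)         ∎
    upper : suc k * indepCoeff A (suc k) ≤ U * indepCoeff A k
    upper = begin
      suc k * indepCoeff A (suc k)         ≡⟨ ∑⊆-extensions k ⟨
      ∑⊆ (λ S → ⟦ I S ⟧ * extensions S)    ≤⟨ ∑⊆-mono-≤ (λ S → ⟦⟧*-mono-≤ (I S) (proj₂ ∘ bounds′ S)) ⟩
      ∑⊆ (λ S → ⟦ I S ⟧ * U)               ≡⟨ scaled U ⟨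
      U * indepCoeff A k                   ∎

module PendantCliques {m : ℕ} (A : Fin m → Fin m → Bool) (irrefl : ∀ x → A x x ≡ false) where

  open IndependentSets A

  -- In H ∘ K_p these are the blocks {v} ∪ K^(v), with v as vertex zero.
  record PendantClique (p : ℕ) : Set where
    field
      vertex      : Fin (suc p) → Fin m
      complete    : ∀ i j → i ≢ j → A (vertex i) (vertex j) ≡ true
      nbr-insideˡ : ∀ a y → A (vertex (suc a)) y ≡ true → ∃ λ i → y ≡ vertex i
      nbr-insideʳ : ∀ a y → A y (vertex (suc a)) ≡ true → ∃ λ i → y ≡ vertex i

  module _ {p : ℕ} (C : PendantClique p) where

    open PendantClique C

    occupancy : Vec Bool m → ℕ
    occupancy S = ∑[ i < suc p ] ⟦ lookup S (vertex i) ⟧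

    cliqueExtensions : Vec Bool m → ℕ
    cliqueExtensions S = ∑[ i < suc p ] ⟦ addable S (vertex i) ⟧

    occupied-clique : ∀ S i → Independent S → lookup S (vertex i) ≡ true →
      occupancy S ≡ 1 × cliqueExtensions S ≡ 0
    occupied-clique S i ind Si = ∑-⟦⟧-unique (lookup S ∘ vertex) i Si others , ∑-zero (cong ⟦_⟧ ∘ blocked)
      where
      others : ∀ j → j ≢ i → lookup S (vertex j) ≡ false
      others j j≢i with lookup S (vertex j) in Sj
      ... | false = refl
      ... | true with () ← trans (sym (complete j i j≢i)) (ind (vertex j) (vertex i) Sj Si)
      blocked : ∀ j → addable S (vertex j) ≡ false
      blocked j with j ≟ᶠ i
      ... | yes refl = addable-member S Si
      ... | no j≢i = addable-adjacent S Si (complete j i j≢i)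

    free-clique : ∀ S → Independent S → (∀ i → lookup S (vertex i) ≡ false) →
      occupancy S ≡ 0 × p ≤ cliqueExtensions S × cliqueExtensions S ≤ suc p
    free-clique S ind free = ∑-zero (cong ⟦_⟧ ∘ free) ,
      subst (p ≤_) (sym total) (m≤n+m p _) , subst (_≤ suc p) (sym total) (+-monoˡ-≤ p (⟦⟧≤1 _))
      where
      outside : ∀ {edge y} → (edge ≡ true → ∃ λ i → y ≡ vertex i) → lookup S y ≡ true → edge ≡ false
      outside {y = y} inside Sy = ¬-not (unoccupied ∘ inside)
        where
        unoccupied : ¬ (∃ λ i → y ≡ vertex i)
        unoccupied (i , refl) with () ← trans (sym Sy) (free i)
      leaf-addable : ∀ a → addable S (vertex (suc a)) ≡ true
      leaf-addable a = addable-isolated S ind (free (suc a)) (irrefl _)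
        (λ y → outside (nbr-insideˡ a y)) (λ y → outside (nbr-insideʳ a y))
      total : cliqueExtensions S ≡ ⟦ addable S (vertex zero) ⟧ + p
      total = cong (⟦ addable S (vertex zero) ⟧ +_) (trans (sum-cong-≗ (cong ⟦_⟧ ∘ leaf-addable)) (∑-one p))

    pendantClique-cases : ∀ S → Independent S →
      (occupancy S ≡ 1 × cliqueExtensions S ≡ 0) ⊎
      (occupancy S ≡ 0 × p ≤ cliqueExtensions S × cliqueExtensions S ≤ suc p)
    pendantClique-cases S ind with any? (λ i → lookup S (vertex i) ≟ᵇ true)
    ... | yes (i , Si) = inj₁ (occupied-clique S i ind Si)
    ... | no none = inj₂ (free-clique S ind (λ i → ¬-not (λ Si → none (i , Si))))

    pendantClique-bounds : ∀ S → Independent S →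
      occupancy S ≤ 1 × p * (1 ∸ occupancy S) ≤ cliqueExtensions S ×
      cliqueExtensions S ≤ suc p * (1 ∸ occupancy S)
    pendantClique-bounds S ind = linearise (pendantClique-cases S ind)
      where
      linearise : ∀ {o e} → (o ≡ 1 × e ≡ 0) ⊎ (o ≡ 0 × p ≤ e × e ≤ suc p) →
        o ≤ 1 × p * (1 ∸ o) ≤ e × e ≤ suc p * (1 ∸ o)
      linearise (inj₁ (refl , refl)) = ≤-refl , ≤-reflexive (*-zeroʳ p) , z≤n
      linearise (inj₂ (refl , lower , upper)) =
        z≤n , ≤-trans (≤-reflexive (*-identityʳ p)) lower ,
        ≤-trans upper (≤-reflexive (sym (*-identityʳ (suc p))))

  -- The hypothesis on sums says that the cliques C v partition the vertex set.
  extensions-bounds : ∀ {n p} (C : Fin n → PendantClique p) →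
    (∀ f → sum f ≡ ∑[ v < n ] ∑[ i < suc p ] f (PendantClique.vertex (C v) i)) →
    ∀ S → Independent S → p * (n ∸ size S) ≤ extensions S × extensions S ≤ suc p * (n ∸ size S)
  extensions-bounds {n} {p} C partition S ind = lower , upper
    where
    open ≤-Reasoning
    occ ext : Fin n → ℕ
    occ v = occupancy (C v) S
    ext v = cliqueExtensions (C v) S
    bounds : ∀ v → occ v ≤ 1 × p * (1 ∸ occ v) ≤ ext v × ext v ≤ suc p * (1 ∸ occ v)
    bounds v = pendantClique-bounds (C v) S ind
    free : ∑[ v < n ] (1 ∸ occ v) ≡ n ∸ size S
    free = trans (∑-1∸ occ (proj₁ ∘ bounds))
                 (cong (n ∸_) (sym (trans (size≡∑ S) (partition (⟦_⟧ ∘ lookup S)))))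
    lower : p * (n ∸ size S) ≤ extensions S
    lower = begin
      p * (n ∸ size S)                ≡⟨ cong (p *_) free ⟨
      p * ∑[ v < n ] (1 ∸ occ v)      ≡⟨ *-distribˡ-sum p (λ v → 1 ∸ occ v) ⟩
      ∑[ v < n ] (p * (1 ∸ occ v))    ≤⟨ ∑-mono-≤ (proj₁ ∘ proj₂ ∘ bounds) ⟩
      ∑[ v < n ] ext v                ≡⟨ partition (⟦_⟧ ∘ addable S) ⟨
      extensions S                    ∎
    upper : extensions S ≤ suc p * (n ∸ size S)
    upper = begin
      extensions S                        ≡⟨ partition (⟦_⟧ ∘ addable S) ⟩
      ∑[ v < n ] ext v                    ≤⟨ ∑-mono-≤ (proj₂ ∘ proj₂ ∘ bounds) ⟩
      ∑[ v < n ] (suc p * (1 ∸ occ v))    ≡⟨ *-distribˡ-sum (suc p) (λ v → 1 ∸ occ v) ⟨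
      suc p * ∑[ v < n ] (1 ∸ occ v)      ≡⟨ cong (suc p *_) free ⟩
      suc p * (n ∸ size S)                ∎

4mn≤[m+n]² : ∀ m n → 4 * (m * n) ≤ (m + n) * (m + n)
4mn≤[m+n]² m n with ≤-total m n
... | inj₁ m≤n with d , refl ← m≤n⇒∃[o]m+o≡n m≤n = ≤-trans (m≤m+n _ (d * d)) (≤-reflexive (square m d))
  where
  square : ∀ m d → 4 * (m * (m + d)) + d * d ≡ (m + (m + d)) * (m + (m + d))
  square = solve-∀
... | inj₂ n≤m with d , refl ← m≤n⇒∃[o]m+o≡n n≤m = ≤-trans (m≤m+n _ (d * d)) (≤-reflexive (square n d))
  where
  square : ∀ n d → 4 * ((n + d) * n) + d * d ≡ (n + d + n) * (n + d + n)
  square = solve-∀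

ratio-bounds⇒s₀s₂≤s₁² : ∀ a r p {s₀ s₁ s₂} .{{_ : NonZero p}} →
  (a + r) * (a + r) ≤ 4 * (a + r + 1) * p →
  p * suc r * s₀ ≤ a * s₁ → suc a * s₂ ≤ suc p * r * s₁ → s₀ * s₂ ≤ s₁ * s₁
ratio-bounds⇒s₀s₂≤s₁² a r p {s₀} {s₁} {s₂} [a+r]²≤ lower upper = *-cancelˡ-≤ K (begin
  K * (s₀ * s₂)                    ≡⟨ regroup p r a s₀ s₂ ⟩
  (p * suc r * s₀) * (suc a * s₂)  ≤⟨ *-mono-≤ lower upper ⟩
  (a * s₁) * (suc p * r * s₁)      ≡⟨ regroup′ a s₁ p r ⟩
  (a * r * suc p) * (s₁ * s₁)      ≤⟨ *-monoˡ-≤ (s₁ * s₁) ar[p+1]≤K ⟩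
  K * (s₁ * s₁)                    ∎)
  where
  open ≤-Reasoning
  K : ℕ
  K = p * suc r * suc a
  instance
    K≢0 : NonZero K
    K≢0 = m*n≢0 (p * suc r) (suc a) {{m*n≢0 p (suc r)}}
  ar≤p[a+r+1] : a * r ≤ p * (a + r + 1)
  ar≤p[a+r+1] = *-cancelˡ-≤ 4 (begin
    4 * (a * r)              ≤⟨ 4mn≤[m+n]² a r ⟩
    (a + r) * (a + r)        ≤⟨ [a+r]²≤ ⟩
    4 * (a + r + 1) * p      ≡⟨ trans (*-assoc 4 (a + r + 1) p) (cong (4 *_) (*-comm (a + r + 1) p)) ⟩
    4 * (p * (a + r + 1))    ∎)
  expand : ∀ p r a → p * (a + r + 1) + a * r * p ≡ p * suc r * suc a
  expand = solve-∀
  ar[p+1]≤K : a * r * suc p ≤ K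
  ar[p+1]≤K = begin
    a * r * suc p                   ≡⟨ *-suc (a * r) p ⟩
    a * r + a * r * p               ≤⟨ +-monoˡ-≤ (a * r * p) ar≤p[a+r+1] ⟩
    p * (a + r + 1) + a * r * p     ≡⟨ expand p r a ⟩
    K                               ∎
  regroup : ∀ p r a s₀ s₂ → p * suc r * suc a * (s₀ * s₂) ≡ (p * suc r * s₀) * (suc a * s₂)
  regroup = solve-∀
  regroup′ : ∀ a s₁ p r → (a * s₁) * (suc p * r * s₁) ≡ (a * r * suc p) * (s₁ * s₁)
  regroup′ = solve-∀

n∸m≡1+[n∸1+m] : ∀ {m n} → m < n → n ∸ m ≡ suc (n ∸ suc m)
n∸m≡1+[n∸1+m] {zero} {suc n} _ = refl
n∸m≡1+[n∸1+m] {suc m} {suc n} (s<s m<n) = n∸m≡1+[n∸1+m] m<n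

ratio-bounds⇒log-concave : ∀ n p (s : ℕ → ℕ) .{{_ : NonZero p}} → n * n ≤ 4 * (n + 1) * p →
  (∀ k → p * (n ∸ k) * s k ≤ suc k * s (suc k) × suc k * s (suc k) ≤ suc p * (n ∸ k) * s k) →
  ∀ k → s k * s (suc (suc k)) ≤ s (suc k) * s (suc k)
ratio-bounds⇒log-concave n p s n²≤ bounds k with suc k ≤? n
... | yes k<n = ratio-bounds⇒s₀s₂≤s₁² (suc k) (n ∸ suc k) p
  (subst (λ t → t * t ≤ 4 * (t + 1) * p) (sym (m+[n∸m]≡n k<n)) n²≤)
  (subst (λ t → p * t * s k ≤ suc k * s (suc k)) (n∸m≡1+[n∸1+m] k<n) (proj₁ (bounds k)))
  (proj₂ (bounds (suc k)))
... | no k≮n = ≤-trans (≤-reflexive (trans (cong (s k *_) vanishes) (*-zeroʳ (s k)))) z≤n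
  where
  open ≤-Reasoning
  vanishes : s (suc (suc k)) ≡ 0
  vanishes = n≤0⇒n≡0 (begin
    s (suc (suc k))                    ≤⟨ m≤n*m _ (suc (suc k)) ⟩
    suc (suc k) * s (suc (suc k))      ≤⟨ proj₂ (bounds (suc k)) ⟩
    suc p * (n ∸ suc k) * s (suc k)    ≡⟨ cong (λ t → suc p * t * s (suc k)) (m≤n⇒m∸n≡0 (<⇒≤ (≰⇒> k≮n))) ⟩
    suc p * 0 * s (suc k)              ≡⟨ cong (_* s (suc k)) (*-zeroʳ (suc p)) ⟩
    0                                  ∎)

module CliqueCorona {n : ℕ} (H : Graph n) (p : ℕ) where

  open IndependentSets (coronaAdj H p)

  encode : Vtx n p → Fin (n + n * p)
  encode (inj₁ v) = v ↑ˡ (n * p)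
  encode (inj₂ (v , a)) = n ↑ʳ combine v a

  decode∘encode : ∀ y → decode n p (encode y) ≡ y
  decode∘encode (inj₁ v) rewrite splitAt-↑ˡ n v (n * p) = refl
  decode∘encode (inj₂ (v , a)) rewrite splitAt-↑ʳ n (n * p) (combine v a) = cong inj₂ (remQuot-combine v a)

  encode∘decode : ∀ x → encode (decode n p x) ≡ x
  encode∘decode x with splitAt n x | join-splitAt n (n * p) x
  ... | inj₁ v | eq = eq
  ... | inj₂ y | eq = trans (cong (n ↑ʳ_) (combine-remQuot {n} p y)) eq

  coronaAdj-encode : ∀ y z → coronaAdj H p (encode y) (encode z) ≡ coronaAdjV H y z
  coronaAdj-encode y z rewrite decode∘encode y | decode∘encode z = refl

  coronaAdj-encodeˡ : ∀ y x → coronaAdj H p (encode y) x ≡ coronaAdjV H y (decode n p x)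
  coronaAdj-encodeˡ y x rewrite decode∘encode y = refl

  coronaAdj-encodeʳ : ∀ x y → coronaAdj H p x (encode y) ≡ coronaAdjV H (decode n p x) y
  coronaAdj-encodeʳ x y rewrite decode∘encode y = refl

  block : Fin n → Fin (suc p) → Vtx n p
  block v zero = inj₁ v
  block v (suc a) = inj₂ (v , a)

  private
    ⌊≟⌋-refl : ∀ {k} (i : Fin k) → ⌊ i ≟ᶠ i ⌋ ≡ true
    ⌊≟⌋-refl i = trans (isYes≗does (i ≟ᶠ i)) (dec-true (i ≟ᶠ i) refl)

    ⌊≟⌋-≢ : ∀ {k} {i j : Fin k} → i ≢ j → ⌊ i ≟ᶠ j ⌋ ≡ false
    ⌊≟⌋-≢ {i = i} {j} i≢j = trans (isYes≗does (i ≟ᶠ j)) (dec-false (i ≟ᶠ j) i≢j)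

  coronaAdjV-irrefl : ∀ (y : Vtx n p) → coronaAdjV H y y ≡ false
  coronaAdjV-irrefl (inj₁ v) = adj-irr H v
  coronaAdjV-irrefl (inj₂ (v , a)) rewrite ⌊≟⌋-refl v | ⌊≟⌋-refl a = refl

  coronaAdjV-block : ∀ v i j → i ≢ j → coronaAdjV H (block v i) (block v j) ≡ true
  coronaAdjV-block v zero zero 0≢0 = ⊥-elim (0≢0 refl)
  coronaAdjV-block v zero (suc b) _ = ⌊≟⌋-refl v
  coronaAdjV-block v (suc a) zero _ = ⌊≟⌋-refl v
  coronaAdjV-block v (suc a) (suc b) a≢b rewrite ⌊≟⌋-refl v | ⌊≟⌋-≢ (a≢b ∘ cong suc) = refl

  coronaAdjV-inj₂ˡ : ∀ v a z → coronaAdjV H (inj₂ (v , a)) z ≡ true → ∃ λ i → z ≡ block v i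
  coronaAdjV-inj₂ˡ v a (inj₁ u) e with v ≟ᶠ u
  ... | yes refl = zero , refl
  coronaAdjV-inj₂ˡ v a (inj₂ (u , b)) e with v ≟ᶠ u
  ... | yes refl = suc b , refl

  coronaAdjV-inj₂ʳ : ∀ v a z → coronaAdjV H z (inj₂ (v , a)) ≡ true → ∃ λ i → z ≡ block v i
  coronaAdjV-inj₂ʳ v a (inj₁ u) e with u ≟ᶠ v
  ... | yes refl = zero , refl
  coronaAdjV-inj₂ʳ v a (inj₂ (u , b)) e with u ≟ᶠ v
  ... | yes refl = suc b , refl

  coronaAdj-irrefl : ∀ x → coronaAdj H p x x ≡ false
  coronaAdj-irrefl x = coronaAdjV-irrefl (decode n p x)

  open PendantCliques (coronaAdj H p) coronaAdj-irrefl

  pendantClique : Fin n → PendantClique p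
  pendantClique v = record
    { vertex = encode ∘ block v
    ; complete = λ i j i≢j → trans (coronaAdj-encode (block v i) (block v j)) (coronaAdjV-block v i j i≢j)
    ; nbr-insideˡ = λ a x e →
        inside (coronaAdjV-inj₂ˡ v a (decode n p x) (trans (sym (coronaAdj-encodeˡ (inj₂ (v , a)) x)) e))
    ; nbr-insideʳ = λ a x e →
        inside (coronaAdjV-inj₂ʳ v a (decode n p x) (trans (sym (coronaAdj-encodeʳ x (inj₂ (v , a)))) e))
    }
    where
    inside : ∀ {x} → (∃ λ i → decode n p x ≡ block v i) → ∃ λ i → x ≡ encode (block v i)
    inside {x} (i , eq) = i , trans (sym (encode∘decode x)) (cong encode eq)

  ∑-blocks : ∀ f → sum f ≡ ∑[ v < n ] ∑[ i < suc p ] f (encode (block v i))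
  ∑-blocks f = begin
    sum f
      ≡⟨ ∑-↑ˡ-↑ʳ n (n * p) f ⟩
    ∑[ v < n ] f (v ↑ˡ n * p) + ∑[ j < n * p ] f (n ↑ʳ j)
      ≡⟨ cong (∑[ v < n ] f (v ↑ˡ n * p) +_) (∑-combine n p (f ∘ (n ↑ʳ_))) ⟩
    ∑[ v < n ] f (v ↑ˡ n * p) + ∑[ v < n ] ∑[ a < p ] f (n ↑ʳ combine v a)
      ≡⟨ ∑-distrib-+ (λ v → f (v ↑ˡ n * p)) (λ v → ∑[ a < p ] f (n ↑ʳ combine v a)) ⟨
    ∑[ v < n ] ∑[ i < suc p ] f (encode (block v i)) ∎
    where open ≡-Reasoning

  ratio-bounds : ∀ k →
    p * (n ∸ k) * indepCoeff (coronaAdj H p) k ≤ suc k * indepCoeff (coronaAdj H p) (suc k) ×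
    suc k * indepCoeff (coronaAdj H p) (suc k) ≤ suc p * (n ∸ k) * indepCoeff (coronaAdj H p) k
  ratio-bounds k = indepCoeff-ratio-bounds k (p * (n ∸ k)) (suc p * (n ∸ k))
    (λ { S ind refl → extensions-bounds pendantClique ∑-blocks S ind })

corollary3p10 : (n p : ℕ) → (H : Graph n) → 1 ≤ p → n * n ≤ 4 * (n + 1) * p →
    IsLogConcaveIndepPoly (coronaAdj H p)
corollary3p10 _ _ _ _ _ zero () _
corollary3p10 n p H 1≤p n²≤4[n+1]p (suc k) _ _ =
  ratio-bounds⇒log-concave n p (indepCoeff (coronaAdj H p)) {{>-nonZero 1≤p}} n²≤4[n+1]p
    (CliqueCorona.ratio-bounds H p) k
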